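{- Let $\Delta$ be a finite simplicial complex, $v$ a vertex of $\Delta$, and $k$ an integer. The relative simplicial complex $(\mathrm{St}_v\Delta,\ \mathrm{St}_v\Delta - v)$ is resolution $k$-chordal if and only if $\mathrm{Lk}_v\Delta$ is resolution $(k-1)$-chordal.
   Context: Coefficients are in a fixed commutative ring $R$; vertices are totally ordered. The closed star is $\mathrm{St}_\sigma\Delta=\bigcup_{\sigma\subseteq\tau\in\Delta}2^\tau$ and the link is $\mathrm{Lk}_\sigma\Delta=\{\tau\setminus\sigma:\sigma\subseteq\tau\in\Delta\}$. For a face $\sigma$, the deletion $\Delta-\sigma$ is the maximal subcomplex of $\Delta$ not containing $\sigma$ (i.e. all faces containing $\sigma$ are removed). For a relative complex $(\Delta,\Gamma)$ ($\Gamma\subseteq\Delta$ subcomplex), $k$-chains are elements of $C_k(\Delta;R)/C_k(\Gamma;R)$, i.e. $R$-combinations of $k$-faces of $\Delta$ not in $\Gamma$, with the induced boundary map; $C_{ -1}$ of an (absolute) complex is free of rank one on the empty face. The vertex support $c^{(0)}$ of a chain $c$ is the set of vertices in faces with nonzero coefficient in $c$. A $(k+1)$-chain $c$ is a resolution of a $k$-cycle $z$ if $\partial c=z$ and $c^{(0)}=z^{(0)}$. A (relative) complex is resolution $k$-chordal if every $k$-cycle in it admits a resolution in it. -}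

module Defs where

open import Level using (Level; _⊔_; 0ℓ) renaming (suc to lsuc)
open import Algebra.Bundles using (CommutativeRing)
open import Data.Bool using (Bool; true; false; if_then_else_; _∧_)
open import Data.Nat as ℕ using (ℕ; zero; suc)
open import Data.Integer as ℤ using (ℤ; +_; 1ℤ)
open import Data.Fin using (Fin; zero; suc; toℕ)
open import Data.Fin.Subset using (Subset; inside; _∈_; _∉_; _⊆_; ⁅_⁆; ∣_∣; _─_)
open import Data.Vec using (lookup; _[_]≔_)
open import Data.Product using (Σ; _×_)
open import Data.Empty using (⊥)
open import Relation.Nullary using (¬_)
open import Relation.Binary.PropositionalEquality using (_≡_)
open import Function.Bundles using (_⇔_)

-- A face is a subset of Fin n; the complex is a downward closed family of
-- faces (the empty face ∅ is a face as soon as any face exists).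

record SimplicialComplex (n : ℕ) : Set₁ where
  field
    Face       : Subset n → Set
    down-close : ∀ {σ τ} → σ ⊆ τ → Face τ → Face σ
open SimplicialComplex public

dim : ∀ {n} → Subset n → ℤ
dim σ = + ∣ σ ∣ ℤ.- 1ℤ

St : ∀ {n} → Subset n → SimplicialComplex n → (Subset n → Set)
St σ Δ τ = Σ (Subset _) λ ρ → Face Δ ρ × σ ⊆ ρ × τ ⊆ ρ

Lk : ∀ {n} → Subset n → SimplicialComplex n → (Subset n → Set)
Lk σ Δ τ = Σ (Subset _) λ ρ → Face Δ ρ × σ ⊆ ρ × τ ≡ ρ ─ σ

Del : ∀ {n} → (Subset n → Set) → Subset n → (Subset n → Set)
Del K σ τ = K τ × ¬ (σ ⊆ τ)

-- The void complex (no faces at all), used as Γ for absolute complexes.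
Void : ∀ {n} → Subset n → Set
Void _ = ⊥

module Chains {c ℓ : Level} (R : CommutativeRing c ℓ) where
  open CommutativeRing R using (Carrier; _≈_; _+_; -_; 0#)

  sumFin : ∀ {n} → (Fin n → Carrier) → Carrier
  sumFin {zero}  f = 0#
  sumFin {suc n} f = f zero + sumFin (λ i → f (suc i))

  alt : ℕ → Carrier → Carrier
  alt zero    x = x
  alt (suc m) x = - alt m x

  countF : ∀ {m} → (Fin m → Bool) → ℕ
  countF {zero}  p = 0
  countF {suc m} p = (if p zero then 1 else 0) ℕ.+ countF (λ i → p (suc i))

  below : ∀ {n} → Subset n → Fin n → ℕ
  below τ v = countF λ u → (toℕ u ℕ.<ᵇ toℕ v) ∧ lookup τ u

  -- A chain is any function from faces (subsets) to R (all finitely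
  -- supported since Subset n is finite).
  Chain : ℕ → Set c
  Chain n = Subset n → Carrier

  -- Simplicial boundary with the sign convention
  -- ∂[v₀,…,v_k] = Σ (-1)^i [v₀,…,v̂ᵢ,…,v_k] (vertices in increasing order):
  -- the coefficient of τ in ∂c is Σ_{v ∉ τ} (-1)^{#{u ∈ τ : u < v}} c(τ ∪ {v}).
  ∂ : ∀ {n} → Chain n → Chain n
  ∂ c τ = sumFin λ v →
    if lookup τ v then 0# else alt (below τ v) (c (τ [ v ]≔ inside))

  -- c is a k-chain of the relative complex (Δ, Γ): it vanishes outside the
  -- k-faces of Δ that are not in Γ (canonical representatives of
  -- C_k(Δ)/C_k(Γ)).
  IsChain : ∀ {n} → (Subset n → Set) → (Subset n → Set) → ℤ → Chain n → Set ℓ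
  IsChain Δ Γ k z = ∀ σ → ¬ (Δ σ × ¬ Γ σ × dim σ ≡ k) → z σ ≈ 0#

  -- Equality of two (k-1)-chains of (Δ, Γ), i.e. modulo C_{k-1}(Γ).
  EqIn : ∀ {n} → (Subset n → Set) → (Subset n → Set) → ℤ → Chain n → Chain n → Set ℓ
  EqIn Δ Γ k x y = ∀ τ → Δ τ → ¬ Γ τ → dim τ ≡ k → x τ ≈ y τ

  IsCycle : ∀ {n} → (Subset n → Set) → (Subset n → Set) → ℤ → Chain n → Set ℓ
  IsCycle Δ Γ k z = IsChain Δ Γ k z × EqIn Δ Γ (k ℤ.- 1ℤ) (∂ z) (λ _ → 0#)

  _∈supp_ : ∀ {n} → Fin n → Chain n → Set ℓ
  v ∈supp z = Σ (Subset _) λ σ → v ∈ σ × ¬ (z σ ≈ 0#)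

  IsResolution : ∀ {n} → (Subset n → Set) → (Subset n → Set) → ℤ → Chain n → Chain n → Set ℓ
  IsResolution Δ Γ k z w =
    IsChain Δ Γ (k ℤ.+ 1ℤ) w × EqIn Δ Γ k (∂ w) z × (∀ v → (v ∈supp w) ⇔ (v ∈supp z))

  ResChordal : ∀ {n} → (Subset n → Set) → (Subset n → Set) → ℤ → Set (c ⊔ ℓ)
  ResChordal Δ Γ k = ∀ z → IsCycle Δ Γ k z → Σ (Chain _) λ w → IsResolution Δ Γ k z w

module Submission where

-- The relative cells of (St_v Δ, St_v Δ - v) are exactly the faces τ ∪ {v}
-- with τ ∈ Lk_v Δ, and dimension goes up by one.  Coning with v,
--   C x (τ ∪ {v}) = (-1)^{#{u ∈ τ : u < v}} x τ ,
-- therefore identifies (k-1)-chains of the link with k-chains of the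
-- relative star; its inverse is U.  C anticommutes with the boundary
-- (∂-C), so it carries cycles to cycles and resolutions to resolutions up to
-- a sign.  On vertex supports, C adds the apex v exactly when the chain is
-- nonzero; passing back to the link this only requires dropping v, while
-- passing up to the star requires that a resolution w of z is nonzero iff z
-- is (resolution-nonzero).  That fails only for k = -1, where the relative
-- star has no cells at all and is trivially chordal (chordal-without-cells).

open import Defs
open import Level using (Level)
open import Algebra.Bundles using (CommutativeRing)
open import Data.Nat using (ℕ)
open import Data.Integer using (ℤ; _-_; 1ℤ)
open import Data.Fin using (Fin)
open import Data.Fin.Subset using (⁅_⁆)
open import Function.Bundles using (_⇔_)

open import Function.Bundles using (mk⇔; Equivalence)
import Function.Properties.Equivalence as ⇔
open import Data.Bool using (Bool; true; false; if_then_else_; _∧_)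
open import Data.Nat as N using (zero; suc)
import Data.Nat.Properties as NP
open import Data.Integer as Z using (+_; -[1+_])
import Data.Integer.Properties as ZP
open import Data.Fin using (zero; suc; toℕ)
import Data.Fin.Properties as FP
open import Data.Fin.Subset using (Subset; inside; _∈_; _⊆_; _─_; ∣_∣; Nonempty)
import Data.Fin.Subset.Properties as SP
open import Data.Vec using (_∷_; lookup; _[_]≔_)
import Data.Vec.Properties as VP
open import Data.Product using (Σ; _×_; _,_; proj₁; proj₂)
open import Data.Sum using (_⊎_; inj₁; inj₂)
open import Data.Empty using (⊥-elim)
open import Relation.Nullary using (¬_; yes; no)
open import Relation.Binary.PropositionalEquality
  using (_≡_; _≢_; refl; sym; trans; cong; cong₂; subst)
open import Relation.Binary.Bundles using (Setoid)

plus-minus : ∀ a → (a Z.+ 1ℤ) Z.- 1ℤ ≡ a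
plus-minus a = trans (ZP.+-assoc a 1ℤ (Z.- 1ℤ)) (ZP.+-identityʳ a)

minus-plus : ∀ a → (a Z.- 1ℤ) Z.+ 1ℤ ≡ a
minus-plus a = trans (ZP.+-assoc a (Z.- 1ℤ) 1ℤ) (ZP.+-identityʳ a)

shift-pred : ∀ {i j} → i Z.+ 1ℤ ≡ j → (i Z.- 1ℤ) Z.+ 1ℤ ≡ j Z.- 1ℤ
shift-pred {i} s = trans (minus-plus i) (trans (sym (plus-minus i)) (cong (Z._- 1ℤ) s))

<ᵇ-irrefl : ∀ m → (m N.<ᵇ m) ≡ false
<ᵇ-irrefl zero    = refl
<ᵇ-irrefl (suc m) = <ᵇ-irrefl m

<ᵇ-trichotomy : ∀ m n → m ≢ n →
  ((m N.<ᵇ n) ≡ true × (n N.<ᵇ m) ≡ false) ⊎ ((m N.<ᵇ n) ≡ false × (n N.<ᵇ m) ≡ true)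
<ᵇ-trichotomy zero    zero    m≢n = ⊥-elim (m≢n refl)
<ᵇ-trichotomy zero    (suc n) m≢n = inj₁ (refl , refl)
<ᵇ-trichotomy (suc m) zero    m≢n = inj₂ (refl , refl)
<ᵇ-trichotomy (suc m) (suc n) m≢n = <ᵇ-trichotomy m n (λ e → m≢n (cong suc e))

ifᵗ : ∀ {a} {A : Set a} {b : Bool} {x y : A} → b ≡ true → (if b then x else y) ≡ x
ifᵗ refl = refl

ifᶠ : ∀ {a} {A : Set a} {b : Bool} {x y : A} → b ≡ false → (if b then x else y) ≡ y
ifᶠ refl = refl

true≢false : true ≢ false
true≢false ()

subset-ext : ∀ {n} {p q : Subset n} → (∀ i → lookup p i ≡ lookup q i) → p ≡ q
subset-ext {p = p} {q} h =
  trans (sym (VP.tabulate∘lookup p)) (trans (VP.tabulate-cong h) (VP.tabulate∘lookup q))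

lookup-remove-self : ∀ {n} (σ : Subset n) v → lookup (σ ─ ⁅ v ⁆) v ≡ false
lookup-remove-self (_ ∷ σ) zero    = refl
lookup-remove-self (_ ∷ σ) (suc v) = lookup-remove-self σ v

lookup-remove-other : ∀ {n} (σ : Subset n) {u v} → u ≢ v → lookup (σ ─ ⁅ v ⁆) u ≡ lookup σ u
lookup-remove-other (_ ∷ σ) {zero}  {zero}  u≢v = ⊥-elim (u≢v refl)
lookup-remove-other (_ ∷ σ) {zero}  {suc v} u≢v = refl
lookup-remove-other (_ ∷ σ) {suc u} {zero}  u≢v = cong (λ p → lookup p u) (SP.p─⊥≡p σ)
lookup-remove-other (_ ∷ σ) {suc u} {suc v} u≢v =
  lookup-remove-other σ (λ e → u≢v (cong suc e))

∣insert∣ : ∀ {n} (τ : Subset n) v → lookup τ v ≡ false → ∣ τ [ v ]≔ true ∣ ≡ suc ∣ τ ∣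
∣insert∣ (false ∷ τ) zero    refl = refl
∣insert∣ (true  ∷ τ) (suc v) e    = cong suc (∣insert∣ τ v e)
∣insert∣ (false ∷ τ) (suc v) e    = ∣insert∣ τ v e

dim≡-1⇒∣∣≡0 : ∀ {n} (τ : Subset n) → dim τ ≡ -[1+ 0 ] → ∣ τ ∣ ≡ 0
dim≡-1⇒∣∣≡0 τ d with ∣ τ ∣
... | zero = refl

nonempty⇒dim≢-1 : ∀ {n} {τ : Subset n} → Nonempty τ → dim τ ≢ -[1+ 0 ]
nonempty⇒dim≢-1 {τ = τ} (u , u∈τ) d with ∣ τ ∣ | SP.x∈p⇒∣p-x∣<∣p∣ u∈τ | dim≡-1⇒∣∣≡0 τ d
... | zero | () | _

empty⇒dim≡-1 : ∀ {n} {τ : Subset n} → ¬ Nonempty τ → dim τ ≡ -[1+ 0 ]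
empty⇒dim≡-1 {n} {τ} e = cong (λ m → + m Z.- 1ℤ) (trans (cong ∣_∣ (SP.Empty-unique e)) (SP.∣⊥∣≡0 n))

module Proof {c ℓ : Level} (R : CommutativeRing c ℓ) where
  open CommutativeRing R using (Carrier; _≈_; _+_; -_; 0#; setoid; +-cong; -‿cong; ring; +-identityˡ)
  open Setoid setoid using () renaming (refl to ≈-refl; sym to ≈-sym; trans to ≈-trans; reflexive to ≡⇒≈)
  open import Algebra.Properties.Ring ring using (-0#≈0#; -‿involutive; -‿injective; -‿+-comm)
  open import Relation.Binary.Reasoning.Setoid setoid
  open Chains R

  alt-cong : ∀ m {a b} → a ≈ b → alt m a ≈ alt m b
  alt-cong zero    e = e
  alt-cong (suc m) e = -‿cong (alt-cong m e)

  alt-neg : ∀ m a → alt m (- a) ≈ - alt m a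
  alt-neg zero    a = ≈-refl
  alt-neg (suc m) a = -‿cong (alt-neg m a)

  neg-zero : ∀ {a} → a ≈ 0# → - a ≈ 0#
  neg-zero e = ≈-trans (-‿cong e) -0#≈0#

  alt-zero : ∀ m {a} → a ≈ 0# → alt m a ≈ 0#
  alt-zero zero    e = e
  alt-zero (suc m) e = neg-zero (alt-zero m e)

  alt-+ : ∀ m n a → alt (m N.+ n) a ≡ alt m (alt n a)
  alt-+ zero    n a = refl
  alt-+ (suc m) n a = cong -_ (alt-+ m n a)

  alt-comm : ∀ m n a → alt m (alt n a) ≡ alt n (alt m a)
  alt-comm m n a =
    trans (sym (alt-+ m n a)) (trans (cong (λ k → alt k a) (NP.+-comm m n)) (alt-+ n m a))

  alt-involutive : ∀ m a → alt m (alt m a) ≈ a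
  alt-involutive zero    a = ≈-refl
  alt-involutive (suc m) a =
    ≈-trans (-‿cong (alt-neg m (alt m a))) (≈-trans (-‿involutive _) (alt-involutive m a))

  alt-injective : ∀ m {a b} → alt m a ≈ alt m b → a ≈ b
  alt-injective m {a} {b} e =
    ≈-trans (≈-sym (alt-involutive m a)) (≈-trans (alt-cong m e) (alt-involutive m b))

  alt-reflects-zero : ∀ m {a} → alt m a ≈ 0# → a ≈ 0#
  alt-reflects-zero m e = alt-injective m (≈-trans e (≈-sym (alt-zero m ≈-refl)))

  neg-reflects-zero : ∀ {a} → - a ≈ 0# → a ≈ 0#
  neg-reflects-zero {a} e = ≈-trans (≈-sym (-‿involutive a)) (neg-zero e)

  -- Moving a vertex past another flips the sign: the combinatorial heart of
  -- ∂ ∘ C = - C ∘ ∂.  Exactly one of the two comparisons p, q holds.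
  swap-sign : ∀ (p q : Bool) bu bv a → ((p ≡ true × q ≡ false) ⊎ (p ≡ false × q ≡ true)) →
    alt (if q then suc bu else bu) (alt (if p then suc bv else bv) a) ≈ - alt bv (alt bu a)
  swap-sign .true  .false bu bv a (inj₁ (refl , refl)) =
    ≈-trans (alt-neg bu (alt bv a)) (-‿cong (≡⇒≈ (alt-comm bu bv a)))
  swap-sign .false .true  bu bv a (inj₂ (refl , refl)) = -‿cong (≡⇒≈ (alt-comm bu bv a))

  sum-cong : ∀ {m} {f g : Fin m → Carrier} → (∀ i → f i ≈ g i) → sumFin f ≈ sumFin g
  sum-cong {zero}  h = ≈-refl
  sum-cong {suc m} h = +-cong (h zero) (sum-cong (λ i → h (suc i)))

  sum-neg : ∀ {m} (f : Fin m → Carrier) → sumFin (λ i → - f i) ≈ - sumFin f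
  sum-neg {zero}  f = ≈-sym -0#≈0#
  sum-neg {suc m} f = ≈-trans (+-cong ≈-refl (sum-neg (λ i → f (suc i)))) (-‿+-comm _ _)

  sum-alt : ∀ {m} k (f : Fin m → Carrier) → sumFin (λ i → alt k (f i)) ≈ alt k (sumFin f)
  sum-alt zero    f = ≈-refl
  sum-alt (suc k) f = ≈-trans (sum-neg (λ i → alt k (f i))) (-‿cong (sum-alt k f))

  -- Equality in R need not be decidable, so "all summands vanish" is only
  -- available doubly negated; the conclusion then holds doubly negated too.
  sum-¬¬zero : ∀ {m} (f : Fin m → Carrier) → (∀ i → ¬ ¬ (f i ≈ 0#)) → ¬ ¬ (sumFin f ≈ 0#)
  sum-¬¬zero {zero}  f h k = k ≈-refl
  sum-¬¬zero {suc m} f h k =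
    h zero λ e₀ → sum-¬¬zero (λ i → f (suc i)) (λ i → h (suc i))
      λ e₁ → k (≈-trans (+-cong e₀ e₁) (+-identityˡ 0#))

  countF-ext : ∀ {m} (p q : Fin m → Bool) → (∀ i → p i ≡ q i) → countF p ≡ countF q
  countF-ext {zero}  p q h = refl
  countF-ext {suc m} p q h =
    cong₂ N._+_ (cong (λ b → if b then 1 else 0) (h zero)) (countF-ext _ _ (λ i → h (suc i)))

  countF-bump : ∀ {m} (p q : Fin m → Bool) (a : Fin m) → (∀ i → i ≢ a → p i ≡ q i) →
                p a ≡ false → q a ≡ true → countF q ≡ suc (countF p)
  countF-bump {suc m} p q zero h pa qa rewrite pa | qa =
    cong suc (countF-ext _ _ (λ i → sym (h (suc i) (λ ()))))
  countF-bump {suc m} p q (suc a) h pa qa =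
    trans (cong₂ N._+_ (cong (λ b → if b then 1 else 0) (sym (h zero (λ ()))))
                       (countF-bump _ _ a (λ i i≢a → h (suc i) (λ e → i≢a (FP.suc-injective e))) pa qa))
          (NP.+-suc _ _)

  below-insert : ∀ {n} (ρ : Subset n) (a b : Fin n) → lookup ρ a ≡ false →
    below (ρ [ a ]≔ true) b ≡ (if toℕ a N.<ᵇ toℕ b then suc (below ρ b) else below ρ b)
  below-insert ρ a b ρa with toℕ a N.<ᵇ toℕ b in a<b
  ... | true = countF-bump _ _ a
                 (λ i i≢a → cong ((toℕ i N.<ᵇ toℕ b) ∧_) (sym (VP.lookup∘update′ i≢a ρ true)))
                 (cong₂ _∧_ a<b ρa) (cong₂ _∧_ a<b (VP.lookup∘update a ρ true))
  ... | false = sym (countF-ext _ _ same)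
    where
    same : ∀ i → ((toℕ i N.<ᵇ toℕ b) ∧ lookup ρ i) ≡ ((toℕ i N.<ᵇ toℕ b) ∧ lookup (ρ [ a ]≔ true) i)
    same i with i FP.≟ a
    ... | yes refl = trans (cong (_∧ lookup ρ a) a<b) (sym (cong (_∧ lookup (ρ [ a ]≔ true) a) a<b))
    ... | no i≢a = cong ((toℕ i N.<ᵇ toℕ b) ∧_) (sym (VP.lookup∘update′ i≢a ρ true))

  Cell : ∀ {n} → (Subset n → Set) → (Subset n → Set) → ℤ → Subset n → Set
  Cell K Γ j σ = K σ × ¬ Γ σ × dim σ ≡ j

  at-cell : ∀ {n} {K Γ : Subset n → Set} {j a b σ} → EqIn K Γ j a b → Cell K Γ j σ → a σ ≈ b σ
  at-cell eq (Kσ , ¬Γσ , d) = eq _ Kσ ¬Γσ d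

  neg : ∀ {n} → Chain n → Chain n
  neg x σ = - x σ

  Nonzero : ∀ {n} → Chain n → Set ℓ
  Nonzero x = Σ (Subset _) λ σ → ¬ (x σ ≈ 0#)

  ∂-term : ∀ {n} → Chain n → Subset n → Fin n → Carrier
  ∂-term x τ u = if lookup τ u then 0# else alt (below τ u) (x (τ [ u ]≔ inside))

  ∂-term-zero : ∀ {n} (x : Chain n) τ u → x (τ [ u ]≔ inside) ≈ 0# → ∂-term x τ u ≈ 0#
  ∂-term-zero x τ u e with lookup τ u
  ... | true  = ≈-refl
  ... | false = alt-zero (below τ u) e

  ∂-cong : ∀ {n} {x y : Chain n} → (∀ σ → x σ ≈ y σ) → ∀ τ → ∂ x τ ≈ ∂ y τ
  ∂-cong {x = x} {y} h τ = sum-cong term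
    where
    term : ∀ u → ∂-term x τ u ≈ ∂-term y τ u
    term u with lookup τ u
    ... | true  = ≈-refl
    ... | false = alt-cong (below τ u) (h (τ [ u ]≔ inside))

  ∂-neg : ∀ {n} (x : Chain n) τ → ∂ (neg x) τ ≈ - ∂ x τ
  ∂-neg x τ = ≈-trans (sum-cong term) (sum-neg (∂-term x τ))
    where
    term : ∀ u → ∂-term (neg x) τ u ≈ - ∂-term x τ u
    term u with lookup τ u
    ... | true  = ≈-sym -0#≈0#
    ... | false = alt-neg (below τ u) (x (τ [ u ]≔ inside))

  neg-chain : ∀ {n} {K Γ : Subset n → Set} {j x} → IsChain K Γ j x → IsChain K Γ j (neg x)
  neg-chain xch σ not-cell = neg-zero (xch σ not-cell)

  supp-cong : ∀ {n} {x y : Chain n} → (∀ σ → x σ ≈ y σ) → ∀ u → u ∈supp x ⇔ u ∈supp y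
  supp-cong h u = mk⇔ (λ (σ , u∈σ , nz) → σ , u∈σ , λ e → nz (≈-trans (h σ) e))
                      (λ (σ , u∈σ , nz) → σ , u∈σ , λ e → nz (≈-trans (≈-sym (h σ)) e))

  supp-neg : ∀ {n} (x : Chain n) u → u ∈supp neg x ⇔ u ∈supp x
  supp-neg x u = mk⇔ (λ (σ , u∈σ , nz) → σ , u∈σ , λ e → nz (neg-zero e))
                     (λ (σ , u∈σ , nz) → σ , u∈σ , λ e → nz (neg-reflects-zero e))

  -- A relative complex without j-cells is trivially resolution j-chordal:
  -- its only j-cycle is 0, resolved by 0.
  chordal-without-cells : ∀ {n} {K Γ : Subset n → Set} {j} →
    (∀ σ → ¬ Cell K Γ j σ) → ResChordal K Γ j
  chordal-without-cells no-cell z (zch , _) =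
    (λ _ → 0#) , (λ _ _ → ≈-refl) , (λ τ Kτ ¬Γτ d → ⊥-elim (no-cell τ (Kτ , ¬Γτ , d))) ,
    λ u → mk⇔ (λ (_ , _ , nz) → ⊥-elim (nz ≈-refl))
              (λ (σ , _ , nz) → ⊥-elim (nz (zch σ (no-cell σ))))

  -- A (-1)-chain lives on the empty face, so its support has no vertices.
  no-vertices-in-degree-1 : ∀ {n} {K Γ : Subset n → Set} {z} →
    IsChain K Γ -[1+ 0 ] z → ∀ u → ¬ (u ∈supp z)
  no-vertices-in-degree-1 zch u (σ , u∈σ , nz) =
    nz (zch σ λ (_ , _ , d) → nonempty⇒dim≢-1 (u , u∈σ) d)

  ∂-of-vertexless : ∀ {n} (w : Chain n) → (∀ u → ¬ (u ∈supp w)) → ∀ τ → ¬ ¬ (∂ w τ ≈ 0#)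
  ∂-of-vertexless w no-vertex τ = sum-¬¬zero (∂-term w τ) λ u nz →
    no-vertex u (τ [ u ]≔ inside , VP.[]≔-updates τ u , λ e → nz (∂-term-zero w τ u e))

  chain-nonzero⇒nonempty : ∀ {n} {K Γ : Subset n → Set} {j x σ} →
    IsChain K Γ j x → j ≢ -[1+ 0 ] → ¬ (x σ ≈ 0#) → Nonempty σ
  chain-nonzero⇒nonempty {σ = σ} xch j≢-1 nz with SP.nonempty? σ
  ... | yes ne = ne
  ... | no e   = ⊥-elim (nz (xch σ λ (_ , _ , d) → j≢-1 (trans (sym d) (empty⇒dim≡-1 e))))

  nonzero-via-vertex : ∀ {n} {x y : Chain n} → (∀ u → u ∈supp x → u ∈supp y) →
    ∀ σ → ¬ (x σ ≈ 0#) → Nonempty σ → Nonzero y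
  nonzero-via-vertex f σ nz (u , u∈σ) with f u (σ , u∈σ , nz)
  ... | ρ , _ , nzρ = ρ , nzρ

  -- If w resolves the j-cycle z and j + 1 ≠ -1, then w ≠ 0 iff z ≠ 0.  The
  -- supports agree, so only chains supported on the empty face matter: w
  -- cannot be one (degree j + 1 ≠ -1), and if z is one then j = -1, w has no
  -- vertices, and z = ∂ w vanishes.
  resolution-nonzero : ∀ {n} {K Γ : Subset n → Set} {j z w} → j Z.+ 1ℤ ≢ -[1+ 0 ] →
    IsChain K Γ j z → IsResolution K Γ j z w → Nonzero w ⇔ Nonzero z
  resolution-nonzero {K = K} {Γ} {j} {z} {w} j+1≢-1 zch (wch , wbd , wsupp) = mk⇔ up down
    where
    up : Nonzero w → Nonzero z
    up (σ , nz) = nonzero-via-vertex (λ u → Equivalence.to (wsupp u)) σ nz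
                    (chain-nonzero⇒nonempty wch j+1≢-1 nz)
    down : Nonzero z → Nonzero w
    down (σ , nz) with SP.nonempty? σ
    ... | yes ne = nonzero-via-vertex (λ u → Equivalence.from (wsupp u)) σ nz ne
    ... | no e   = ⊥-elim (nz (zch σ not-cell))
      where
      not-cell : ¬ Cell K Γ j σ
      not-cell (Kσ , ¬Γσ , d) = ∂-of-vertexless w no-vertex σ λ ∂w≈0 →
        nz (≈-trans (≈-sym (at-cell wbd (Kσ , ¬Γσ , d))) ∂w≈0)
        where
        j≡-1 : j ≡ -[1+ 0 ]
        j≡-1 = trans (sym d) (empty⇒dim≡-1 e)
        no-vertex : ∀ u → ¬ (u ∈supp w)
        no-vertex u u∈w = no-vertices-in-degree-1 (subst (λ i → IsChain K Γ i z) j≡-1 zch) u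
                            (Equivalence.to (wsupp u) u∈w)

  module Cone {n : ℕ} (Δ : SimplicialComplex n) (v : Fin n) where

    StarV LinkV DelV : Subset n → Set
    StarV = St ⁅ v ⁆ Δ
    LinkV = Lk ⁅ v ⁆ Δ
    DelV  = Del StarV ⁅ v ⁆

    add : Subset n → Subset n
    add τ = τ [ v ]≔ true

    rem : Subset n → Subset n
    rem σ = σ ─ ⁅ v ⁆

    add-rem : ∀ σ → lookup σ v ≡ true → add (rem σ) ≡ σ
    add-rem σ σv = subset-ext same
      where
      same : ∀ i → lookup (add (rem σ)) i ≡ lookup σ i
      same i with i FP.≟ v
      ... | yes refl = trans (VP.lookup∘update v (rem σ) true) (sym σv)
      ... | no i≢v   = trans (VP.lookup∘update′ i≢v (rem σ) true) (lookup-remove-other σ i≢v)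

    rem-add : ∀ τ → lookup τ v ≡ false → rem (add τ) ≡ τ
    rem-add τ τv = subset-ext same
      where
      same : ∀ i → lookup (rem (add τ)) i ≡ lookup τ i
      same i with i FP.≟ v
      ... | yes refl = trans (lookup-remove-self (add τ) v) (sym τv)
      ... | no i≢v   = trans (lookup-remove-other (add τ) i≢v) (VP.lookup∘update′ i≢v τ true)

    data ConeView : Subset n → Set where
      off  : ∀ {σ} → lookup σ v ≡ false → ConeView σ
      apex : ∀ {τ} → lookup τ v ≡ false → ConeView (add τ)

    cone-view : ∀ σ → ConeView σ
    cone-view σ with lookup σ v in σv
    ... | false = off σv
    ... | true  = subst ConeView (add-rem σ σv) (apex (lookup-remove-self σ v))

    v∈add : ∀ τ → v ∈ add τ
    v∈add τ = VP.[]≔-updates τ v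

    ∈-add : ∀ {u τ} → u ∈ τ → u ∈ add τ
    ∈-add {u} {τ} u∈τ with u FP.≟ v
    ... | yes refl = v∈add τ
    ... | no u≢v   = VP.[]≔-minimal τ u v u≢v u∈τ

    ∈-add⁻ : ∀ {u τ} → u ∈ add τ → u ≢ v → u ∈ τ
    ∈-add⁻ {u} {τ} u∈ u≢v =
      VP.lookup⇒[]= u τ (trans (sym (VP.lookup∘update′ u≢v τ true)) (VP.[]=⇒lookup u∈))

    below-add : ∀ τ → lookup τ v ≡ false → below (add τ) v ≡ below τ v
    below-add τ τv = trans (below-insert τ v v τv) (ifᶠ (<ᵇ-irrefl (toℕ v)))

    add-insert : ∀ τ {u} → u ≢ v → add τ [ u ]≔ true ≡ add (τ [ u ]≔ true)
    add-insert τ u≢v = VP.[]≔-commutes τ v _ (λ e → u≢v (sym e))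

    dim-add : ∀ τ → lookup τ v ≡ false → dim (add τ) ≡ dim τ Z.+ 1ℤ
    dim-add τ τv =
      trans (cong (λ m → + m Z.- 1ℤ) (∣insert∣ τ v τv)) (sym (minus-plus (+ ∣ τ ∣)))

    link-misses-v : ∀ {τ} → LinkV τ → lookup τ v ≡ false
    link-misses-v (ρ , _ , _ , refl) = lookup-remove-self ρ v

    ⁅v⁆⊆ : ∀ {σ} → lookup σ v ≡ true → ⁅ v ⁆ ⊆ σ
    ⁅v⁆⊆ {σ} σv x∈ = subst (_∈ σ) (sym (SP.x∈⁅y⁆⇒x≡y v x∈)) (VP.lookup⇒[]= v σ σv)

    cell-contains-v : ∀ {σ} → StarV σ → ¬ DelV σ → lookup σ v ≡ true
    cell-contains-v {σ} st not-del with lookup σ v in σv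
    ... | true  = refl
    ... | false = ⊥-elim (not-del (st , λ v⊆σ →
                    true≢false (trans (sym (VP.[]=⇒lookup (v⊆σ (SP.x∈⁅x⁆ v)))) σv)))

    cell-up : ∀ {i j τ} → i Z.+ 1ℤ ≡ j → Cell LinkV Void i τ → Cell StarV DelV j (add τ)
    cell-up {τ = τ} s ((ρ , Fρ , v⊆ρ , refl) , _ , d) =
      (ρ , Fρ , v⊆ρ , add⊆ρ) , (λ (_ , v∉) → v∉ (⁅v⁆⊆ (VP.[]=⇒lookup (v∈add τ)))) ,
      trans (dim-add τ (lookup-remove-self ρ v)) (trans (cong (Z._+ 1ℤ) d) s)
      where
      add⊆ρ : add τ ⊆ ρ
      add⊆ρ {x} x∈ with x FP.≟ v
      ... | yes refl = v⊆ρ (SP.x∈⁅x⁆ v)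
      ... | no x≢v   = SP.p─q⊆p ρ ⁅ v ⁆ (∈-add⁻ x∈ x≢v)

    cell-down : ∀ {i j τ} → i Z.+ 1ℤ ≡ j → lookup τ v ≡ false →
                Cell StarV DelV j (add τ) → Cell LinkV Void i τ
    cell-down {i} {j} {τ} s τv ((ρ , Fρ , _ , add⊆ρ) , _ , d) =
      (add τ , down-close Δ add⊆ρ Fρ , ⁅v⁆⊆ (VP.[]=⇒lookup (v∈add τ)) , sym (rem-add τ τv)) ,
      (λ ()) ,
      trans (sym (plus-minus (dim τ)))
            (trans (cong (Z._- 1ℤ) (trans (sym (dim-add τ τv)) (trans d (sym s)))) (plus-minus i))

    EqIn-from-link : ∀ {i j a b} → i Z.+ 1ℤ ≡ j →
      (∀ τ → Cell LinkV Void i τ → a (add τ) ≈ b (add τ)) → EqIn StarV DelV j a b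
    EqIn-from-link s on-link σ st not-del d with cone-view σ
    ... | off σv  = ⊥-elim (true≢false (trans (sym (cell-contains-v st not-del)) σv))
    ... | apex τv = on-link _ (cell-down s τv (st , not-del , d))

    Avoids : Chain n → Set ℓ
    Avoids x = ∀ τ → lookup τ v ≡ true → x τ ≈ 0#

    OnApex : Chain n → Set ℓ
    OnApex y = ∀ σ → lookup σ v ≡ false → y σ ≈ 0#

    link-chain-avoids : ∀ {i x} → IsChain LinkV Void i x → Avoids x
    link-chain-avoids xch τ τv = xch τ λ (lk , _) → true≢false (trans (sym τv) (link-misses-v lk))

    star-chain-on-apex : ∀ {j y} → IsChain StarV DelV j y → OnApex y
    star-chain-on-apex ych σ σv = ych σ λ (st , not-del , _) →
      true≢false (trans (sym (cell-contains-v st not-del)) σv)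

    C : Chain n → Chain n
    C x σ = if lookup σ v then alt (below σ v) (x (rem σ)) else 0#

    U : Chain n → Chain n
    U y τ = if lookup τ v then 0# else alt (below τ v) (y (add τ))

    C-off : ∀ x σ → lookup σ v ≡ false → C x σ ≡ 0#
    C-off x σ = ifᶠ

    C-add : ∀ x τ → lookup τ v ≡ false → C x (add τ) ≡ alt (below τ v) (x τ)
    C-add x τ τv =
      trans (ifᵗ (VP.lookup∘update v τ true)) (cong₂ alt (below-add τ τv) (cong x (rem-add τ τv)))

    U-off : ∀ y τ → lookup τ v ≡ false → U y τ ≡ alt (below τ v) (y (add τ))
    U-off y τ = ifᶠ

    U-avoids : ∀ y → Avoids (U y)
    U-avoids y τ τv = ≡⇒≈ (ifᵗ τv)

    C-U : ∀ y → OnApex y → ∀ σ → C (U y) σ ≈ y σ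
    C-U y on-apex σ with cone-view σ
    ... | off σv  = ≈-trans (≡⇒≈ (C-off (U y) σ σv)) (≈-sym (on-apex σ σv))
    ... | apex {τ} τv =
      ≈-trans (≡⇒≈ (trans (C-add (U y) τ τv) (cong (alt (below τ v)) (U-off y τ τv))))
              (alt-involutive (below τ v) (y (add τ)))

    -- The summand of ∂ (C x) at the cone over τ for the vertex u is the
    -- summand of ∂ x at τ, with the sign flipped: for u = v both vanish, and
    -- otherwise inserting u and v in either order differs by one transposition.
    ∂-C-term : ∀ x → Avoids x → ∀ τ → lookup τ v ≡ false → ∀ u →
               ∂-term (C x) (add τ) u ≈ - alt (below τ v) (∂-term x τ u)
    ∂-C-term x avoids τ τv u with u FP.≟ v
    ... | yes refl = ≈-trans (≡⇒≈ (ifᵗ (VP.lookup∘update v τ true)))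
        (≈-sym (neg-zero (alt-zero (below τ v) (∂-term-zero x τ v (avoids (add τ) (VP.lookup∘update v τ true))))))
    ... | no u≢v with lookup τ u in τu
    ...   | true  = ≈-trans (≡⇒≈ (ifᵗ (trans (VP.lookup∘update′ u≢v τ true) τu)))
                            (≈-sym (neg-zero (alt-zero (below τ v) ≈-refl)))
    ...   | false = begin
      ∂-term (C x) (add τ) u
        ≡⟨ ifᶠ (trans (VP.lookup∘update′ u≢v τ true) τu) ⟩
      alt (below (add τ) u) (C x (add τ [ u ]≔ true))
        ≡⟨ cong (alt (below (add τ) u)) (trans (cong (C x) (add-insert τ u≢v)) (C-add x τ′ τ′v)) ⟩
      alt (below (add τ) u) (alt (below τ′ v) (x τ′))
        ≡⟨ cong₂ (λ p q → alt p (alt q (x τ′))) (below-insert τ v u τv) (below-insert τ u v τu) ⟩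
      alt (if toℕ v N.<ᵇ toℕ u then suc (below τ u) else below τ u)
          (alt (if toℕ u N.<ᵇ toℕ v then suc (below τ v) else below τ v) (x τ′))
        ≈⟨ swap-sign _ _ (below τ u) (below τ v) (x τ′)
             (<ᵇ-trichotomy (toℕ u) (toℕ v) (λ e → u≢v (FP.toℕ-injective e))) ⟩
      - alt (below τ v) (alt (below τ u) (x τ′)) ∎
      where
      τ′ : Subset n
      τ′ = τ [ u ]≔ true
      τ′v : lookup τ′ v ≡ false
      τ′v = trans (VP.lookup∘update′ (λ e → u≢v (sym e)) τ true) τv

    ∂-C : ∀ x → Avoids x → ∀ τ → lookup τ v ≡ false →
          ∂ (C x) (add τ) ≈ - alt (below τ v) (∂ x τ)
    ∂-C x avoids τ τv = begin
      ∂ (C x) (add τ)                                 ≈⟨ sum-cong (∂-C-term x avoids τ τv) ⟩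
      sumFin (λ u → - alt (below τ v) (∂-term x τ u)) ≈⟨ sum-neg (λ u → alt (below τ v) (∂-term x τ u)) ⟩
      - sumFin (λ u → alt (below τ v) (∂-term x τ u)) ≈⟨ -‿cong (sum-alt (below τ v) (∂-term x τ)) ⟩
      - alt (below τ v) (∂ x τ)                       ∎

    -- The same relation read for a star chain y = C (U y).
    ∂-U : ∀ y → OnApex y → ∀ τ → lookup τ v ≡ false →
          ∂ y (add τ) ≈ - alt (below τ v) (∂ (U y) τ)
    ∂-U y on-apex τ τv =
      ≈-trans (∂-cong (λ σ → ≈-sym (C-U y on-apex σ)) (add τ)) (∂-C (U y) (U-avoids y) τ τv)

    C-chain : ∀ {i j x} → i Z.+ 1ℤ ≡ j → IsChain LinkV Void i x → IsChain StarV DelV j (C x)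
    C-chain {x = x} s xch σ not-cell with cone-view σ
    ... | off σv      = ≡⇒≈ (C-off x σ σv)
    ... | apex {τ} τv = ≈-trans (≡⇒≈ (C-add x τ τv))
                          (alt-zero (below τ v) (xch τ λ cell → not-cell (cell-up s cell)))

    U-chain : ∀ {i j y} → i Z.+ 1ℤ ≡ j → IsChain StarV DelV j y → IsChain LinkV Void i (U y)
    U-chain {y = y} s ych τ not-cell with lookup τ v in τv
    ... | true  = ≈-refl
    ... | false = alt-zero (below τ v) (ych (add τ) λ cell → not-cell (cell-down s τv cell))

    C-cycle : ∀ {i j x} → i Z.+ 1ℤ ≡ j → IsCycle LinkV Void i x → IsCycle StarV DelV j (C x)
    C-cycle {i} {x = x} s (xch , x-closed) = C-chain s xch , EqIn-from-link (shift-pred {i} s) closed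
      where
      closed : ∀ τ → Cell LinkV Void _ τ → ∂ (C x) (add τ) ≈ 0#
      closed τ cell@(lk , _) = ≈-trans (∂-C x (link-chain-avoids xch) τ (link-misses-v lk))
                                       (neg-zero (alt-zero (below τ v) (at-cell x-closed cell)))

    U-cycle : ∀ {i j y} → i Z.+ 1ℤ ≡ j → IsCycle StarV DelV j y → IsCycle LinkV Void i (U y)
    U-cycle {i} {y = y} s (ych , y-closed) = U-chain s ych , closed
      where
      closed : EqIn LinkV Void _ (∂ (U y)) (λ _ → 0#)
      closed τ lk _ d = alt-reflects-zero (below τ v) (neg-reflects-zero
        (≈-trans (≈-sym (∂-U y (star-chain-on-apex ych) τ (link-misses-v lk)))
                 (at-cell y-closed (cell-up (shift-pred {i} s) (lk , (λ ()) , d)))))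

    supp-avoids : ∀ {x u} → Avoids x → u ∈supp x → u ≢ v
    supp-avoids avoids (σ , u∈σ , nz) refl = nz (avoids σ (VP.[]=⇒lookup u∈σ))

    C-nonzero : ∀ {x τ} → Avoids x → ¬ (x τ ≈ 0#) → ¬ (C x (add τ) ≈ 0#)
    C-nonzero {x} {τ} avoids nz with lookup τ v in τv
    ... | true  = ⊥-elim (nz (avoids τ τv))
    ... | false = λ e → nz (alt-reflects-zero (below τ v) (≈-trans (≡⇒≈ (sym (C-add x τ τv))) e))

    supp-C-up : ∀ {x u} → Avoids x → u ∈supp x → u ∈supp C x
    supp-C-up avoids (τ , u∈τ , nz) = add τ , ∈-add u∈τ , C-nonzero avoids nz

    apex-in-supp : ∀ {x} → Avoids x → Nonzero x → v ∈supp C x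
    apex-in-supp avoids (τ , nz) = add τ , v∈add τ , C-nonzero avoids nz

    supp-C-down : ∀ {x u} → u ∈supp C x → Nonzero x × (u ≢ v → u ∈supp x)
    supp-C-down {x} (σ , u∈σ , nz) with cone-view σ
    ... | off σv      = ⊥-elim (nz (≡⇒≈ (C-off x σ σv)))
    ... | apex {τ} τv = (τ , nzτ) , λ u≢v → τ , ∈-add⁻ u∈σ u≢v , nzτ
      where
      nzτ : ¬ (x τ ≈ 0#)
      nzτ e = nz (≈-trans (≡⇒≈ (C-add x τ τv)) (alt-zero (below τ v) e))

    supp-C-reflect : ∀ {a b} → Avoids a → Avoids b →
      (∀ u → u ∈supp C a ⇔ u ∈supp C b) → ∀ u → u ∈supp a ⇔ u ∈supp b
    supp-C-reflect avoids-a avoids-b same u =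
      mk⇔ (reflect avoids-a (λ u → Equivalence.to (same u)))
          (reflect avoids-b (λ u → Equivalence.from (same u)))
      where
      reflect : ∀ {x y} → Avoids x → (∀ u → u ∈supp C x → u ∈supp C y) → u ∈supp x → u ∈supp y
      reflect avoids f u∈x = proj₂ (supp-C-down (f u (supp-C-up avoids u∈x))) (supp-avoids avoids u∈x)

    supp-C-preserve : ∀ {a b} → Avoids a → Avoids b → (∀ u → u ∈supp a ⇔ u ∈supp b) →
      Nonzero a ⇔ Nonzero b → ∀ u → u ∈supp C a ⇔ u ∈supp C b
    supp-C-preserve avoids-a avoids-b same nonzero u =
      mk⇔ (preserve avoids-b (λ u → Equivalence.to (same u)) (Equivalence.to nonzero))
          (preserve avoids-a (λ u → Equivalence.from (same u)) (Equivalence.from nonzero))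
      where
      preserve : ∀ {x y} → Avoids y → (∀ u → u ∈supp x → u ∈supp y) →
                 (Nonzero x → Nonzero y) → u ∈supp C x → u ∈supp C y
      preserve avoids f g u∈Cx with supp-C-down u∈Cx | u FP.≟ v
      ... | nz , _   | yes refl = apex-in-supp avoids (g nz)
      ... | _  , sub | no u≢v   = supp-C-up avoids (f u (sub u≢v))

    -- Resolutions in the relative star give resolutions in the link: resolve
    -- the cone C z′ of a link cycle z′ by w; then - U w resolves z′.
    descend : ∀ k → ResChordal StarV DelV k → ResChordal LinkV Void (k - 1ℤ)
    descend k chordal z′ z′-cycle with chordal (C z′) (C-cycle (minus-plus k) z′-cycle)
    ... | w , w-chain , w-bd , w-supp =
      neg (U w) , neg-chain (U-chain (cong (Z._+ 1ℤ) (minus-plus k)) w-chain) , bd , supp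
      where
      on-apex : OnApex w
      on-apex = star-chain-on-apex w-chain
      bd : EqIn LinkV Void (k - 1ℤ) (∂ (neg (U w))) z′
      bd τ lk _ d = alt-injective (below τ v) (begin
        alt (below τ v) (∂ (neg (U w)) τ) ≈⟨ alt-cong (below τ v) (∂-neg (U w) τ) ⟩
        alt (below τ v) (- ∂ (U w) τ)     ≈⟨ alt-neg (below τ v) (∂ (U w) τ) ⟩
        - alt (below τ v) (∂ (U w) τ)     ≈⟨ ∂-U w on-apex τ τv ⟨
        ∂ w (add τ)                       ≈⟨ at-cell w-bd (cell-up (minus-plus k) (lk , (λ ()) , d)) ⟩
        C z′ (add τ)                      ≡⟨ C-add z′ τ τv ⟩
        alt (below τ v) (z′ τ)            ∎)
        where
        τv : lookup τ v ≡ false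
        τv = link-misses-v lk
      supp : ∀ u → u ∈supp neg (U w) ⇔ u ∈supp z′
      supp u = ⇔.trans (supp-neg (U w) u)
        (supp-C-reflect (U-avoids w) (link-chain-avoids (proj₁ z′-cycle))
          (λ u → ⇔.trans (supp-cong (C-U w on-apex) u) (w-supp u)) u)

    -- Resolutions in the link give resolutions in the relative star: resolve
    -- U z of a star cycle z by w′; then - C w′ resolves z.  For k = -1 the
    -- relative star has no cells, as every cell contains v.
    ascend : ∀ k → ResChordal LinkV Void (k - 1ℤ) → ResChordal StarV DelV k
    ascend k chordal with k ZP.≟ -[1+ 0 ]
    ... | yes refl = chordal-without-cells λ σ (st , not-del , d) →
                       nonempty⇒dim≢-1 (v , VP.lookup⇒[]= v σ (cell-contains-v st not-del)) d
    ... | no k≢-1 = resolve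
      where
      resolve : ResChordal StarV DelV k
      resolve z z-cycle with chordal (U z) (U-cycle (minus-plus k) z-cycle)
      ... | w′ , w′-chain , w′-bd , w′-supp =
        neg (C w′) , neg-chain (C-chain (cong (Z._+ 1ℤ) (minus-plus k)) w′-chain) , bd , supp
        where
        bd : EqIn StarV DelV k (∂ (neg (C w′))) z
        bd = EqIn-from-link (minus-plus k) λ τ cell@(lk , _) →
          let τv = link-misses-v lk in begin
          ∂ (neg (C w′)) (add τ)                      ≈⟨ ∂-neg (C w′) (add τ) ⟩
          - ∂ (C w′) (add τ)                          ≈⟨ -‿cong (∂-C w′ (link-chain-avoids w′-chain) τ τv) ⟩
          - - alt (below τ v) (∂ w′ τ)                ≈⟨ -‿involutive _ ⟩
          alt (below τ v) (∂ w′ τ)                    ≈⟨ alt-cong (below τ v) (at-cell w′-bd cell) ⟩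
          alt (below τ v) (U z τ)                     ≡⟨ cong (alt (below τ v)) (U-off z τ τv) ⟩
          alt (below τ v) (alt (below τ v) (z (add τ))) ≈⟨ alt-involutive (below τ v) (z (add τ)) ⟩
          z (add τ)                                   ∎
        w′-nonzero : Nonzero w′ ⇔ Nonzero (U z)
        w′-nonzero = resolution-nonzero (λ e → k≢-1 (trans (sym (minus-plus k)) e))
          (U-chain (minus-plus k) (proj₁ z-cycle)) (w′-chain , w′-bd , w′-supp)
        supp : ∀ u → u ∈supp neg (C w′) ⇔ u ∈supp z
        supp u = ⇔.trans (supp-neg (C w′) u)
          (⇔.trans (supp-C-preserve (link-chain-avoids w′-chain) (U-avoids z) w′-supp w′-nonzero u)
                   (supp-cong (C-U z (star-chain-on-apex (proj₁ z-cycle))) u))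

lemma4p1 : ∀ {c ℓ : Level} (R : CommutativeRing c ℓ) {n : ℕ}
    (Δ : SimplicialComplex n) (v : Fin n) → Face Δ ⁅ v ⁆ → (k : ℤ) →
    Chains.ResChordal R (St ⁅ v ⁆ Δ) (Del (St ⁅ v ⁆ Δ) ⁅ v ⁆) k
    ⇔ Chains.ResChordal R (Lk ⁅ v ⁆ Δ) Void (k - 1ℤ)
lemma4p1 R Δ v _ k = mk⇔ (descend k) (ascend k)
  where open Proof.Cone R Δ v
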